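{- Let $G$ be a monochromatic graph that contains a complete bipartite graph $H$ as a spanning subgraph such that each partite set of $H$ contains (the two endpoints of) an edge of $G$. Then $pc_{opt}(G)\le 3$.
   Context: All graphs are finite and simple. An edge-colored graph is properly colored if no two adjacent edges share a color; an edge-colored connected graph is properly connected if between every pair of distinct vertices there is a properly colored path. A monochromatic graph is one in which every edge has color $0$; any color $i\neq 0$ is a new color. For a monochromatic connected graph $G$, $pc_{opt}(G)$ is the minimum of $p+q$ over all ways to make $G$ properly connected by recoloring $p$ edges of $G$ using $q$ new colors. -}

module Defs where

open import Data.Nat using (ℕ; zero; suc; _+_; _≤_; _<ᵇ_; _≡ᵇ_)
open import Data.Fin using (Fin; toℕ)
open import Data.Bool using (Bool; true; false; _∧_; not; if_then_else_)
open import Data.List using (List; []; _∷_; _++_; map; allFin)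
open import Data.Nat.ListAction using (sum)
open import Data.List.Relation.Unary.Unique.Propositional using (Unique)
open import Data.Product using (Σ; _×_; ∃; ∃-syntax)
open import Data.Unit using (⊤)
open import Relation.Binary.PropositionalEquality using (_≡_; _≢_)

record Graph (n : ℕ) : Set where
  field
    adj   : Fin n → Fin n → Bool
    sym   : ∀ u v → adj u v ≡ adj v u
    irref : ∀ u → adj u u ≡ false
open Graph public

-- An edge coloring: the color of edge uv is col u v (symmetric).
-- Color 0 is the original (monochromatic) color; colors i ≠ 0 are new colors.
-- Values on non-edges are irrelevant.
record Coloring {n : ℕ} (G : Graph n) : Set where
  field
    col    : Fin n → Fin n → ℕ
    colSym : ∀ u v → col u v ≡ col v u
open Coloring public

AdjChain : ∀ {n} → Graph n → List (Fin n) → Set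
AdjChain G (x ∷ y ∷ rest) = adj G x y ≡ true × AdjChain G (y ∷ rest)
AdjChain G _ = ⊤

ProperChain : ∀ {n} {G : Graph n} → Coloring G → List (Fin n) → Set
ProperChain c (x ∷ y ∷ z ∷ rest) = col c x y ≢ col c y z × ProperChain c (y ∷ z ∷ rest)
ProperChain c _ = ⊤

ProperPath : ∀ {n} {G : Graph n} → Coloring G → Fin n → Fin n → Set
ProperPath {n} {G} c u v =
  Σ (List (Fin n)) λ mid →
    Unique (u ∷ mid ++ v ∷ []) × AdjChain G (u ∷ mid ++ v ∷ []) × ProperChain c (u ∷ mid ++ v ∷ [])

ProperlyConnected : ∀ {n} {G : Graph n} → Coloring G → Set
ProperlyConnected {n} c = ∀ (u v : Fin n) → u ≢ v → ProperPath c u v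

-- number of edges of G whose color is not 0 (each edge {u,v} counted once, via toℕ u < toℕ v)
isRecolored : ∀ {n} {G : Graph n} → Coloring G → Fin n → Fin n → Bool
isRecolored {G = G} c u v = adj G u v ∧ (toℕ u <ᵇ toℕ v) ∧ not (col c u v ≡ᵇ 0)

numRecolored : ∀ {n} {G : Graph n} → Coloring G → ℕ
numRecolored {n} c =
  sum (map (λ u → sum (map (λ v → if isRecolored c u v then 1 else 0) (allFin n))) (allFin n))

-- every edge has color in {0,1,...,q}: recolored edges use only the q new colors 1..q
UsesNewColors : ∀ {n} {G : Graph n} → Coloring G → ℕ → Set
UsesNewColors {n} {G} c q = ∀ (u v : Fin n) → adj G u v ≡ true → col c u v ≤ q

-- pc_opt(G) ≤ k : G (monochromatic, color 0) can be made properly connected by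
-- recoloring p edges with q new colors, where p + q ≤ k.
PcOptAtMost : ∀ {n} → Graph n → ℕ → Set
PcOptAtMost {n} G k =
  ∃[ c ] ∃[ p ] ∃[ q ] (numRecolored {G = G} c ≡ p × UsesNewColors c q × p + q ≤ k × ProperlyConnected c)

-- G contains a complete bipartite spanning subgraph H with parts
-- {v | side v ≡ false} and {v | side v ≡ true}: every vertex lies in one part and
-- every vertex of one part is adjacent in G to every vertex of the other part.
ContainsSpanningCompleteBipartite : ∀ {n} → Graph n → (Fin n → Bool) → Set
ContainsSpanningCompleteBipartite {n} G side =
  ∀ (x y : Fin n) → side x ≡ false → side y ≡ true → adj G x y ≡ true

PartContainsEdge : ∀ {n} → Graph n → (Fin n → Bool) → Bool → Set
PartContainsEdge {n} G side b =
  ∃[ x ] ∃[ y ] (side x ≡ b × side y ≡ b × adj G x y ≡ true)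

module Submission where

-- Pick an edge a₀b₀ of G inside the part labelled false and an edge a₁b₁
-- inside the part labelled true, recolor exactly these two edges with the
-- single new color 1 and leave every other edge with color 0; so p ≤ 2, q = 1.
-- * Two vertices in different parts are joined by an edge of H, a proper
--   path of length one.
-- * Two distinct vertices u, v in the same part use the recolored edge ab of
--   the other part: u a b v is a path of H-edges and ab, colored 0, 1, 0.
-- The file first develops double sums over pairs of vertices (to bound the
-- number of recolored edges), then colorings that mark a list of edges with
-- the new color 1 together with their count and their behaviour on edges of H,
-- then proper connectivity of any coloring of a bipartite-spanned graph that
-- keeps H-edges at color 0 and has a recolored edge inside each part.

open import Defs hiding (sym)
open import Defs using () renaming (sym to adj-sym)
open import Data.Nat using (ℕ; zero; suc; _+_; _≤_; _<_; _<ᵇ_; _≡ᵇ_; z≤n; s≤s)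
open import Data.Nat.Properties
  using (≤-refl; ≤-reflexive; ≤-trans; +-mono-≤; +-monoˡ-≤; <-cmp; <-asym; <ᵇ⇒<; +-commutativeSemigroup; module ≤-Reasoning)
open import Algebra.Properties.CommutativeSemigroup +-commutativeSemigroup using (interchange)
open import Data.Fin using (Fin; toℕ; _≟_)
open import Data.Fin.Properties using (toℕ-injective)
open import Data.Bool using (Bool; true; false; _∧_; _∨_; not; if_then_else_; T)
open import Data.Bool.Properties using (∧-comm; ∨-comm; ∧-distribʳ-∨; T-∧; T-∨; not-¬)
  renaming (_≟_ to _≟ᵇ_)
open import Data.List using (List; []; _∷_; map; allFin; tabulate; length)
open import Data.List.Properties using (map-tabulate)
open import Data.Nat.ListAction using (sum)
open import Data.List.Relation.Unary.All using (All; []; _∷_)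
open import Data.List.Relation.Unary.AllPairs using ([]; _∷_)
open import Data.List.Relation.Unary.Any using (here; there)
open import Data.List.Membership.Propositional using (_∈_)
open import Data.Product using (_×_; _,_; ∃-syntax; proj₁; proj₂)
open import Data.Sum using (_⊎_; inj₁; inj₂)
open import Data.Unit using (tt)
open import Function using (_∘_; Equivalence)
open import Relation.Nullary using (does; yes; no; ¬_; contradiction)
open import Relation.Nullary.Decidable using (dec-true)
open import Relation.Binary using (tri<; tri≈; tri>)
open import Relation.Binary.PropositionalEquality
  using (_≡_; _≢_; refl; sym; trans; cong; cong₂; subst₂; module ≡-Reasoning)

indicator : Bool → ℕ
indicator b = if b then 1 else 0

indicator-≤1 : ∀ b → indicator b ≤ 1
indicator-≤1 false = z≤n
indicator-≤1 true  = ≤-refl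

indicator-mono : ∀ {x y} → (T x → T y) → indicator x ≤ indicator y
indicator-mono {false}         _   = z≤n
indicator-mono {true}  {true}  _   = ≤-refl
indicator-mono {true}  {false} x⇒y = contradiction tt x⇒y

indicator-true : ∀ {b} → T b → indicator b ≢ 0
indicator-true {true} _ ()

indicator-false : ∀ {b} → ¬ T b → indicator b ≡ 0
indicator-false {false} _  = refl
indicator-false {true}  ¬b = contradiction tt ¬b

indicator-∨ : ∀ x y → indicator (x ∨ y) ≤ indicator x + indicator y
indicator-∨ false y = ≤-refl
indicator-∨ true  y = s≤s z≤n

sum-map-mono : ∀ {A : Set} {f g : A → ℕ} (xs : List A) →
  (∀ x → f x ≤ g x) → sum (map f xs) ≤ sum (map g xs)
sum-map-mono []       f≤g = z≤n
sum-map-mono (x ∷ xs) f≤g = +-mono-≤ (f≤g x) (sum-map-mono xs f≤g)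

sum-map-+ : ∀ {A : Set} (f g : A → ℕ) (xs : List A) →
  sum (map (λ x → f x + g x) xs) ≡ sum (map f xs) + sum (map g xs)
sum-map-+ f g []       = refl
sum-map-+ f g (x ∷ xs) = begin
  f x + g x + sum (map (λ x → f x + g x) xs)   ≡⟨ cong (f x + g x +_) (sum-map-+ f g xs) ⟩
  f x + g x + (sum (map f xs) + sum (map g xs)) ≡⟨ interchange (f x) (g x) _ _ ⟩
  f x + sum (map f xs) + (g x + sum (map g xs)) ∎
  where open ≡-Reasoning

sum-map-cong : ∀ {A : Set} {f g : A → ℕ} (xs : List A) →
  (∀ x → f x ≡ g x) → sum (map f xs) ≡ sum (map g xs)
sum-map-cong []       f≡g = refl
sum-map-cong (x ∷ xs) f≡g = cong₂ _+_ (f≡g x) (sum-map-cong xs f≡g)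

vertexSum : ∀ {n} → (Fin n → ℕ) → ℕ
vertexSum {n} f = sum (map f (allFin n))

pairSum : ∀ {n} → (Fin n → Fin n → ℕ) → ℕ
pairSum f = vertexSum (λ u → vertexSum (f u))

_≡ᶠ_ : ∀ {n} → Fin n → Fin n → Bool
u ≡ᶠ a = does (u ≟ a)

sum-tabulate-zero : ∀ n → sum (tabulate {n = n} (λ _ → 0)) ≡ 0
sum-tabulate-zero zero    = refl
sum-tabulate-zero (suc n) = sum-tabulate-zero n

vertexSum-zero : ∀ n → vertexSum {n} (λ _ → 0) ≡ 0
vertexSum-zero n = trans (cong sum (map-tabulate {n = n} (λ v → v) (λ _ → 0))) (sum-tabulate-zero n)

vertexSum-point : ∀ {n} (a : Fin n) → vertexSum (λ v → indicator (v ≡ᶠ a)) ≡ 1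
vertexSum-point a = trans (cong sum (map-tabulate (λ v → v) (λ v → indicator (v ≡ᶠ a)))) (tabulated a)
  where
  tabulated : ∀ {m} (b : Fin m) → sum (tabulate (λ v → indicator (v ≡ᶠ b))) ≡ 1
  tabulated {suc m} Fin.zero    = cong suc (sum-tabulate-zero m)
  tabulated {suc m} (Fin.suc b) = tabulated b

pairSum-point : ∀ {n} (a b : Fin n) → pairSum (λ u v → indicator (u ≡ᶠ a ∧ v ≡ᶠ b)) ≡ 1
pairSum-point {n} a b = trans (sum-map-cong (allFin n) row) (vertexSum-point a)
  where
  row : ∀ u → vertexSum (λ v → indicator (u ≡ᶠ a ∧ v ≡ᶠ b)) ≡ indicator (u ≡ᶠ a)
  row u with u ≡ᶠ a
  ... | true  = vertexSum-point b
  ... | false = vertexSum-zero n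

pairSum-mono : ∀ {n} {f g : Fin n → Fin n → ℕ} →
  (∀ u v → f u v ≤ g u v) → pairSum f ≤ pairSum g
pairSum-mono {n} f≤g = sum-map-mono (allFin n) (λ u → sum-map-mono (allFin n) (f≤g u))

pairSum-+ : ∀ {n} (f g : Fin n → Fin n → ℕ) →
  pairSum (λ u v → f u v + g u v) ≡ pairSum f + pairSum g
pairSum-+ {n} f g =
  trans (sum-map-cong (allFin n) (λ u → sum-map-+ (f u) (g u) (allFin n))) (sum-map-+ _ _ (allFin n))

Edge : ℕ → Set
Edge n = Fin n × Fin n

joins : ∀ {n} → Edge n → Fin n → Fin n → Bool
joins (a , b) u v = (u ≡ᶠ a ∧ v ≡ᶠ b) ∨ (u ≡ᶠ b ∧ v ≡ᶠ a)

marked : ∀ {n} → List (Edge n) → Fin n → Fin n → Bool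
marked []       u v = false
marked (e ∷ es) u v = joins e u v ∨ marked es u v

joins-sym : ∀ {n} (e : Edge n) u v → joins e u v ≡ joins e v u
joins-sym (a , b) u v = begin
  (u ≡ᶠ a ∧ v ≡ᶠ b) ∨ (u ≡ᶠ b ∧ v ≡ᶠ a) ≡⟨ cong₂ _∨_ (∧-comm (u ≡ᶠ a) _) (∧-comm (u ≡ᶠ b) _) ⟩
  (v ≡ᶠ b ∧ u ≡ᶠ a) ∨ (v ≡ᶠ a ∧ u ≡ᶠ b) ≡⟨ ∨-comm (v ≡ᶠ b ∧ u ≡ᶠ a) _ ⟩
  (v ≡ᶠ a ∧ u ≡ᶠ b) ∨ (v ≡ᶠ b ∧ u ≡ᶠ a) ∎
  where open ≡-Reasoning

marked-sym : ∀ {n} (es : List (Edge n)) u v → marked es u v ≡ marked es v u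
marked-sym []       u v = refl
marked-sym (e ∷ es) u v = cong₂ _∨_ (joins-sym e u v) (marked-sym es u v)

markColoring : ∀ {n} (G : Graph n) → List (Edge n) → Coloring G
markColoring G es = record
  { col    = λ u v → indicator (marked es u v)
  ; colSym = λ u v → cong indicator (marked-sym es u v) }

≡ᶠ-sound : ∀ {n} {u a : Fin n} → T (u ≡ᶠ a) → u ≡ a
≡ᶠ-sound {u = u} {a} t with u ≟ a | t
... | yes u≡a | _ = u≡a

≡ᶠ-refl : ∀ {n} (u : Fin n) → u ≡ᶠ u ≡ true
≡ᶠ-refl u = dec-true (u ≟ u) refl

endpoints-sound : ∀ {n} {u v x y : Fin n} → T (u ≡ᶠ x ∧ v ≡ᶠ y) → u ≡ x × v ≡ y
endpoints-sound p with u≡x , v≡y ← Equivalence.to T-∧ p = ≡ᶠ-sound u≡x , ≡ᶠ-sound v≡y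

joins-sound : ∀ {n} (e : Edge n) {u v} → T (joins e u v) →
  (u ≡ proj₁ e × v ≡ proj₂ e) ⊎ (u ≡ proj₂ e × v ≡ proj₁ e)
joins-sound (a , b) j with Equivalence.to T-∨ j
... | inj₁ uv≡ab = inj₁ (endpoints-sound uv≡ab)
... | inj₂ uv≡ba = inj₂ (endpoints-sound uv≡ba)

marked-∈ : ∀ {n} {es : List (Edge n)} {a b} → (a , b) ∈ es → T (marked es a b)
marked-∈ {a = a} {b} (here refl) rewrite ≡ᶠ-refl a | ≡ᶠ-refl b = tt
marked-∈ {es = e ∷ es} (there ab∈es) = Equivalence.from T-∨ (inj₂ (marked-∈ ab∈es))

unmarked-across : ∀ {n} (side : Fin n → Bool) {es : List (Edge n)} →
  All (λ e → side (proj₁ e) ≡ side (proj₂ e)) es →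
  ∀ {u v} → side u ≢ side v → ¬ T (marked es u v)
unmarked-across side [] d ()
unmarked-across side {(a , b) ∷ es} (inside ∷ insides) {u} {v} d m with Equivalence.to T-∨ m
... | inj₂ m′ = unmarked-across side insides d m′
... | inj₁ j with joins-sound (a , b) j
...   | inj₁ (u≡a , v≡b) = d (subst₂ (λ x y → side x ≡ side y) (sym u≡a) (sym v≡b) inside)
...   | inj₂ (u≡b , v≡a) = d (subst₂ (λ x y → side x ≡ side y) (sym u≡b) (sym v≡a) (sym inside))

markedBelow : ∀ {n} → List (Edge n) → Fin n → Fin n → Bool
markedBelow es u v = marked es u v ∧ (toℕ u <ᵇ toℕ v)

joins-below : ∀ {n} {a b u v : Fin n} → toℕ a < toℕ b →
  T (joins (a , b) u v ∧ (toℕ u <ᵇ toℕ v)) → T (u ≡ᶠ a ∧ v ≡ᶠ b)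
joins-below {a = a} {b} {u} {v} a<b p with j , u<v ← Equivalence.to T-∧ p | joins-sound (a , b) {u} {v} j
... | inj₁ (refl , refl) rewrite ≡ᶠ-refl a | ≡ᶠ-refl b = tt
... | inj₂ (refl , refl) = contradiction (<ᵇ⇒< (toℕ b) (toℕ a) u<v) (<-asym a<b)

pairSum-zero : ∀ n → pairSum {n} (λ _ _ → 0) ≡ 0
pairSum-zero n = trans (sum-map-cong (allFin n) (λ _ → vertexSum-zero n)) (vertexSum-zero n)

pairSum-markedBelow : ∀ {n} {es : List (Edge n)} →
  All (λ e → toℕ (proj₁ e) < toℕ (proj₂ e)) es →
  pairSum (λ u v → indicator (markedBelow es u v)) ≤ length es
pairSum-markedBelow {n} [] = ≤-reflexive (pairSum-zero n)
pairSum-markedBelow {es = (a , b) ∷ es} (a<b ∷ ordered) = begin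
  pairSum (λ u v → indicator (markedBelow ((a , b) ∷ es) u v))
    ≤⟨ pairSum-mono split ⟩
  pairSum (λ u v → indicator (u ≡ᶠ a ∧ v ≡ᶠ b) + indicator (markedBelow es u v))
    ≡⟨ pairSum-+ (λ u v → indicator (u ≡ᶠ a ∧ v ≡ᶠ b)) (λ u v → indicator (markedBelow es u v)) ⟩
  pairSum (λ u v → indicator (u ≡ᶠ a ∧ v ≡ᶠ b)) + pairSum (λ u v → indicator (markedBelow es u v))
    ≤⟨ +-mono-≤ (≤-reflexive (pairSum-point a b)) (pairSum-markedBelow ordered) ⟩
  suc (length es) ∎
  where
  open ≤-Reasoning
  split : ∀ u v → indicator (markedBelow ((a , b) ∷ es) u v)
                  ≤ indicator (u ≡ᶠ a ∧ v ≡ᶠ b) + indicator (markedBelow es u v)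
  split u v rewrite ∧-distribʳ-∨ (toℕ u <ᵇ toℕ v) (joins (a , b) u v) (marked es u v) =
    ≤-trans (indicator-∨ (joins (a , b) u v ∧ (toℕ u <ᵇ toℕ v)) (markedBelow es u v))
            (+-mono-≤ (indicator-mono (joins-below {u = u} {v} a<b)) ≤-refl)

indicator-nonzero : ∀ b → T (not (indicator b ≡ᵇ 0)) → T b
indicator-nonzero true _ = tt

numRecolored-markColoring : ∀ {n} (G : Graph n) {es : List (Edge n)} →
  All (λ e → toℕ (proj₁ e) < toℕ (proj₂ e)) es →
  numRecolored {G = G} (markColoring G es) ≤ length es
numRecolored-markColoring G {es} ordered =
  ≤-trans (pairSum-mono (λ u v → indicator-mono (recolored⇒markedBelow u v)))
          (pairSum-markedBelow ordered)
  where
  recolored⇒markedBelow : ∀ u v → T (isRecolored (markColoring G es) u v) → T (markedBelow es u v)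
  recolored⇒markedBelow u v r
    with _ , rest ← Equivalence.to (T-∧ {adj G u v}) r
    with below , nonzero ← Equivalence.to T-∧ rest
    = Equivalence.from T-∧ (indicator-nonzero (marked es u v) nonzero , below)

adjacent⇒distinct : ∀ {n} (G : Graph n) {a b} → adj G a b ≡ true → a ≢ b
adjacent⇒distinct G {a} ab refl with () ← trans (sym (irref G a)) ab

module _ {n} {G : Graph n} (side : Fin n → Bool) where

  distinct-across : ∀ {u v} → side u ≢ side v → u ≢ v
  distinct-across d refl = d refl

  KeepsAcross : Coloring G → Set
  KeepsAcross c = ∀ x y → side x ≢ side y → col c x y ≡ 0

  NewEdgeIn : Coloring G → Bool → Set
  NewEdgeIn c s = ∃[ a ] ∃[ b ] (side a ≡ s × side b ≡ s × adj G a b ≡ true × col c a b ≢ 0)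

  module _ (spanned : ContainsSpanningCompleteBipartite G side) where

    adjacent-across : ∀ {u v} → side u ≢ side v → adj G u v ≡ true
    adjacent-across {u} {v} d with side u in su | side v in sv
    ... | false | true  = spanned u v su sv
    ... | true  | false = trans (adj-sym G u v) (spanned v u sv su)
    ... | false | false = contradiction refl d
    ... | true  | true  = contradiction refl d

    crossPath : (c : Coloring G) {u v : Fin n} → side u ≢ side v → ProperPath c u v
    crossPath c d = [] , ((distinct-across d ∷ []) ∷ [] ∷ []) , (adjacent-across d , tt) , tt

    -- u, v distinct in one part and ab a newly colored edge of the other part:
    -- the path u a b v is colored 0, new, 0
    detourPath : (c : Coloring G) → KeepsAcross c → ∀ {a b u v} →
      adj G a b ≡ true → col c a b ≢ 0 → side a ≢ side u → side b ≢ side u →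
      side v ≡ side u → u ≢ v → ProperPath c u v
    detourPath c keeps {a} {b} {u} {v} ab new au bu vu u≢v =
      (a ∷ b ∷ []) ,
      ((u≢a ∷ u≢b ∷ u≢v ∷ []) ∷ (adjacent⇒distinct G ab ∷ a≢v ∷ []) ∷ (b≢v ∷ []) ∷ [] ∷ []) ,
      (adjacent-across ua , ab , adjacent-across bv , tt) ,
      ((λ ua≡ab → new (trans (sym ua≡ab) (keeps u a ua))) ,
       (λ ab≡bv → new (trans ab≡bv (keeps b v bv))) , tt)
      where
      ua : side u ≢ side a
      ua = au ∘ sym
      bv : side b ≢ side v
      bv b≡v = bu (trans b≡v vu)
      u≢a : u ≢ a
      u≢a = distinct-across ua
      u≢b : u ≢ b
      u≢b = distinct-across (bu ∘ sym)
      a≢v : a ≢ v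
      a≢v = distinct-across (λ a≡v → au (trans a≡v vu))
      b≢v : b ≢ v
      b≢v = distinct-across bv

    properlyConnected : (c : Coloring G) → KeepsAcross c → (∀ s → NewEdgeIn c s) → ProperlyConnected c
    properlyConnected c keeps newEdge u v u≢v with side u ≟ᵇ side v
    ... | no d = crossPath c d
    ... | yes same with a , b , sa , sb , ab , new ← newEdge (not (side u)) =
      detourPath c keeps ab new (opposite sa) (opposite sb) (sym same) u≢v
      where
      opposite : ∀ {x} → side x ≡ not (side u) → side x ≢ side u
      opposite sx x≡u = not-¬ refl (trans (sym x≡u) sx)

orientEdge : ∀ {n} (G : Graph n) {side : Fin n → Bool} {s} → PartContainsEdge G side s →
  ∃[ a ] ∃[ b ] (toℕ a < toℕ b × side a ≡ s × side b ≡ s × adj G a b ≡ true)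
orientEdge G (x , y , sx , sy , xy) with <-cmp (toℕ x) (toℕ y)
... | tri< x<y _ _ = x , y , x<y , sx , sy , xy
... | tri≈ _ x≡y _ = contradiction (toℕ-injective x≡y) (adjacent⇒distinct G xy)
... | tri> _ _ y<x = y , x , y<x , sy , sx , trans (adj-sym G y x) xy

proposition3 : ∀ (n : ℕ) (G : Graph n) (side : Fin n → Bool)
    → ContainsSpanningCompleteBipartite G side
    → PartContainsEdge G side false
    → PartContainsEdge G side true
    → PcOptAtMost G 3
proposition3 n G side spanned edgeFalse edgeTrue
  with a₀ , b₀ , a₀<b₀ , sa₀ , sb₀ , a₀b₀ ← orientEdge G edgeFalse
  with a₁ , b₁ , a₁<b₁ , sa₁ , sb₁ , a₁b₁ ← orientEdge G edgeTrue =
  c , numRecolored {G = G} c , 1 , refl , (λ u v _ → indicator-≤1 (marked chosen u v)) ,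
  +-monoˡ-≤ 1 (numRecolored-markColoring G (a₀<b₀ ∷ a₁<b₁ ∷ [])) ,
  properlyConnected side spanned c keeps newEdge
  where
  chosen : List (Edge n)
  chosen = (a₀ , b₀) ∷ (a₁ , b₁) ∷ []
  c : Coloring G
  c = markColoring G chosen
  keeps : KeepsAcross side c
  keeps x y d = indicator-false (unmarked-across side (trans sa₀ (sym sb₀) ∷ trans sa₁ (sym sb₁) ∷ []) d)
  newEdge : ∀ s → NewEdgeIn side c s
  newEdge false = a₀ , b₀ , sa₀ , sb₀ , a₀b₀ , indicator-true (marked-∈ {es = chosen} (here refl))
  newEdge true  = a₁ , b₁ , sa₁ , sb₁ , a₁b₁ , indicator-true (marked-∈ {es = chosen} (there (here refl)))
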